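{- Let $d\ge 3$, let $S$ be a multiset of non-negative integers, let $\xi$ be a vertex of the infinite $d$-regular tree $\mathbb{T}_d$, and let $L$ be the link of $(\xi,\dots,\xi)$ in the polygraph $(\mathbb{T}_d)_S$. If $L$ is connected, then either (i) $0\in S$, or (ii) there is a positive $s\in S$ such that $2s\in S$, or (iii) there are three distinct $s,s',s''\in S$ with $s''=s+s'$.
   Context: With $\rho$ the graph metric of $\mathbb{T}_d$ and $S=[l_1,\dots,l_m]$, the polygraph $(\mathbb{T}_d)_S$ has vertex set $V(\mathbb{T}_d)^m$, and $(x_1,\dots,x_m)\sim(y_1,\dots,y_m)$ iff the multiset $[\rho(x_1,y_1),\dots,\rho(x_m,y_m)]$ equals $S$. The link of a vertex is the subgraph induced on its neighbours. -}

module Defs where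

open import Data.Nat using (ℕ; zero; suc; _≤_)
open import Data.Fin using (Fin)
open import Data.Fin.Properties using () renaming (_≟_ to _≟ᶠ_)
open import Data.Bool using (Bool; true; false; _∧_; T; not)
open import Data.List using (List; []; _∷_; length)
open import Data.Vec using (Vec; lookup; toList)
open import Data.Product using (Σ; Σ-syntax; ∃; _×_; _,_)
open import Data.Sum using (_⊎_)
open import Relation.Nullary using (¬_)
open import Relation.Nullary.Decidable using (⌊_⌋)
open import Relation.Binary.PropositionalEquality using (_≡_)
open import Relation.Binary.Construct.Closure.ReflexiveTransitive using (Star)
open import Data.List.Relation.Binary.Permutation.Propositional using (_↭_)

-- The infinite d-regular tree T_d, realised as the Cayley graph of the
-- free product of d copies of Z/2: vertices are reduced words over the
-- alphabet Fin d (no two consecutive equal letters).  Words are stored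
-- with the most recently appended letter at the head of the list.

noBack : {d : ℕ} → Fin d → List (Fin d) → Bool
noBack a []      = true
noBack a (b ∷ w) = not ⌊ a ≟ᶠ b ⌋

reduced : {d : ℕ} → List (Fin d) → Bool
reduced []      = true
reduced (a ∷ w) = noBack a w ∧ reduced w

TreeV : ℕ → Set
TreeV d = Σ (List (Fin d)) (λ w → T (reduced w))

TreeAdj : {d : ℕ} → TreeV d → TreeV d → Set
TreeAdj {d} (u , _) (v , _) = (Σ (Fin d) λ a → v ≡ a ∷ u) ⊎ (Σ (Fin d) λ a → u ≡ a ∷ v)

data Walk {A : Set} (E : A → A → Set) : A → A → ℕ → Set where
  here  : ∀ {x} → Walk E x x zero
  step  : ∀ {x y z n} → E x y → Walk E y z n → Walk E x z (suc n)

Dist : {A : Set} → (A → A → Set) → A → A → ℕ → Set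
Dist E x y n = Walk E x y n × (∀ k → Walk E x y k → n ≤ k)

ρ≡ : {d : ℕ} → TreeV d → TreeV d → ℕ → Set
ρ≡ = Dist TreeAdj

-- The polygraph (T_d)_S for S = [l_1,…,l_m] (a multiset, given as a list
-- considered up to permutation; m = length S).

PolyV : ℕ → List ℕ → Set
PolyV d S = Vec (TreeV d) (length S)

PolyAdj : (d : ℕ) (S : List ℕ) → PolyV d S → PolyV d S → Set
PolyAdj d S xs ys =
  Σ[ ns ∈ Vec ℕ (length S) ]
    ((∀ i → ρ≡ (lookup xs i) (lookup ys i) (lookup ns i)) × (toList ns ↭ S))

-- Link of a vertex: subgraph induced on its neighbours (a vertex is not
-- its own neighbour: graphs are simple / loopless).

InLink : (d : ℕ) (S : List ℕ) → PolyV d S → PolyV d S → Set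
InLink d S c y = PolyAdj d S c y × ¬ (y ≡ c)

LinkV : (d : ℕ) (S : List ℕ) → PolyV d S → Set
LinkV d S c = Σ (PolyV d S) (InLink d S c)

LinkAdj : (d : ℕ) (S : List ℕ) (c : PolyV d S) → LinkV d S c → LinkV d S c → Set
LinkAdj d S c (u , _) (v , _) = PolyAdj d S u v

LinkConnected : (d : ℕ) (S : List ℕ) → PolyV d S → Set
LinkConnected d S c =
  LinkV d S c × (∀ (u v : LinkV d S c) → Star (LinkAdj d S c) u v)

-- Suppose no element of S is 0 and no element of S is the sum of two (possibly equal) elements
-- of S.  Call a link vertex "on the x-side" if its first coordinate lies in the branch of T_d
-- hanging off ξ through the letter x.  Along a link edge u ∼ v the first coordinates are at
-- distances a, b ∈ S from ξ and at distance c ∈ S from each other; if the geodesic between them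
-- passed through ξ we would get c = a + b.  Hence an edge never leaves the x-side, so the link is
-- disconnected: as d ≥ 3 there are two letters x ≠ y both extending the word of ξ, and the
-- vertices obtained by walking out along the x- and y-branches lie on different sides.
module Submission where

open import Defs
open import Data.Nat using (ℕ; _≤_; _<_; _+_; _*_; zero; suc; s≤s; z<s)
open import Data.Nat.Properties
  using (+-identityʳ; +-suc; ≤-antisym; ≤-trans; ≤-refl; ≤-reflexive; +-mono-≤; +-monoʳ-≤;
         n≤1+n; m≤n⇒m≤1+n; +-cancelʳ-≤; <⇒≢; m<m+n; m<n+m)
  renaming (_≟_ to _≟ℕ_)
open import Data.Fin using (Fin; zero; suc)
open import Data.Fin.Properties using () renaming (_≟_ to _≟ᶠ_)
open import Data.Bool using (T)
open import Data.Bool.Properties using (T-∧; T-irrelevant)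
open import Data.Empty using (⊥-elim)
open import Data.List using (List; []; _∷_; [_]; length; _++_; _∷ʳ_)
open import Data.List.Properties using (≡-dec; ∷-injectiveʳ; ++-assoc; ++-cancelʳ; ∷ʳ-injectiveʳ)
open import Data.List.Membership.Propositional using (_∈_)
open import Data.List.Relation.Unary.Any using (here)
open import Data.List.Relation.Binary.Permutation.Propositional using (_↭_; ↭-reflexive)
open import Data.List.Relation.Binary.Permutation.Propositional.Properties using (∈-resp-↭)
open import Data.Vec using (Vec; replicate; lookup; toList; fromList; map; head)
open import Data.Vec.Properties using (lookup-replicate; lookup-map; toList∘fromList)
open import Data.Vec.Membership.Propositional.Properties using (∈-lookup; ∈-toList⁺)
open import Data.Product using (Σ-syntax; _×_; _,_; proj₁)
open import Data.Sum using (_⊎_; inj₁; inj₂; [_,_]′)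
open import Function using (id; _∘_)
open import Function.Bundles using (Equivalence)
open import Relation.Nullary using (¬_; yes; no)
open import Relation.Nullary.Decidable using (fromWitnessFalse)
open import Relation.Binary.Definitions using (Symmetric)
open import Relation.Binary.PropositionalEquality using (_≡_; refl; sym; trans; cong; subst; subst₂)
open import Relation.Binary.Construct.Closure.ReflexiveTransitive using (Star; fold)

module _ {A : Set} {E : A → A → Set} where

  _▻_ : ∀ {x y z n} → Walk E x y n → E y z → Walk E x z (suc n)
  here     ▻ e = step e here
  step f W ▻ e = step f (W ▻ e)

  _◅◅_ : ∀ {x y z m n} → Walk E x y m → Walk E y z n → Walk E x z (m + n)
  here     ◅◅ W′ = W′
  step e W ◅◅ W′ = step e (W ◅◅ W′)

  reverse : Symmetric E → ∀ {x y n} → Walk E x y n → Walk E y x n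
  reverse sym here               = here
  reverse sym (step {x} {y} e W) = reverse sym W ▻ sym {x} {y} e

  Dist-suc⇒≢ : ∀ {x y n} → Dist E x y (suc n) → ¬ y ≡ x
  Dist-suc⇒≢ (_ , minimal) refl with minimal 0 here
  ... | ()

  Dist-through : Symmetric E → ∀ {m x y a b c k₁ k₂} →
    Dist E m x a → Dist E m y b → Dist E x y c →
    Walk E x m k₁ → Walk E m y k₂ → k₁ + k₂ ≡ c → c ≡ a + b
  Dist-through sym (Wa , min-a) (Wb , min-b) (_ , min-c) W₁ W₂ refl =
    ≤-antisym (min-c _ (reverse sym Wa ◅◅ Wb))
              (+-mono-≤ (min-a _ (reverse sym W₁)) (min-b _ W₂))

alternating : ∀ {A : Set} → A → A → ℕ → A
alternating x y zero    = x
alternating x y (suc n) = alternating y x n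

alternating-≢ : ∀ {A : Set} {x y : A} n → ¬ x ≡ y → ¬ alternating x y n ≡ alternating y x n
alternating-≢ zero    x≢y = x≢y
alternating-≢ (suc n) x≢y = alternating-≢ n (x≢y ∘ sym)

Conclusion : List ℕ → Set
Conclusion S =
  (0 ∈ S)
  ⊎ (Σ[ s ∈ ℕ ] (s ∈ S × 0 < s × 2 * s ∈ S))
  ⊎ (Σ[ s ∈ ℕ ] Σ[ s′ ∈ ℕ ] Σ[ s″ ∈ ℕ ]
       (s ∈ S × s′ ∈ S × s″ ∈ S
        × ¬ (s ≡ s′) × ¬ (s ≡ s″) × ¬ (s′ ≡ s″)
        × s″ ≡ s + s′))

sum-∈⇒Conclusion : ∀ {S a b c} → a ∈ S → b ∈ S → c ∈ S → c ≡ a + b → Conclusion S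
sum-∈⇒Conclusion {a = zero} a∈S _ _ _ = inj₁ a∈S
sum-∈⇒Conclusion {b = zero} _ b∈S _ _ = inj₁ b∈S
sum-∈⇒Conclusion {S} {suc a} {suc b} a∈S b∈S c∈S refl with suc a ≟ℕ suc b
... | yes refl = inj₂ (inj₁ (suc a , a∈S , z<s ,
                   subst (_∈ S) (cong (suc a +_) (sym (+-identityʳ (suc a)))) c∈S))
... | no a≢b   = inj₂ (inj₂ (suc a , suc b , _ , a∈S , b∈S , c∈S ,
                   a≢b , <⇒≢ (m<m+n (suc a) z<s) , <⇒≢ (m<n+m (suc b) z<s) , refl))

word : ∀ {d} → TreeV d → List (Fin d)
word = proj₁

reduced-∷ : ∀ {d} (a : Fin d) w → T (noBack a w) → T (reduced w) → T (reduced (a ∷ w))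
reduced-∷ a w a-fresh w-reduced = Equivalence.from T-∧ (a-fresh , w-reduced)

TreeAdj-sym : ∀ {d} → Symmetric (TreeAdj {d})
TreeAdj-sym (inj₁ e) = inj₂ e
TreeAdj-sym (inj₂ e) = inj₁ e

TreeAdj-length-≤ : ∀ {d} {u v : TreeV d} → TreeAdj u v → length (word v) ≤ suc (length (word u))
TreeAdj-length-≤ {u = _ , _} {_ , _} (inj₁ (_ , refl)) = ≤-refl
TreeAdj-length-≤ {u = _ , _} {_ , _} (inj₂ (_ , refl)) = m≤n⇒m≤1+n (n≤1+n _)

walk-length-≤ : ∀ {d} {u v : TreeV d} {k} → Walk TreeAdj u v k → length (word v) ≤ k + length (word u)
walk-length-≤ here = ≤-refl
walk-length-≤ {u = u} (step {y = y} {n = n} e W) =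
  ≤-trans (walk-length-≤ W)
    (≤-trans (+-monoʳ-≤ n (TreeAdj-length-≤ {u = u} {v = y} e))
             (≤-reflexive (+-suc n (length (word u)))))

-- The component of T_d minus w that contains the neighbour x ∷ w.
InBranch : ∀ {d} → List (Fin d) → Fin d → TreeV d → Set
InBranch w x v = Σ[ p ∈ List _ ] word v ≡ p ++ x ∷ w

InBranch-unique : ∀ {d} {w : List (Fin d)} {x y v} → InBranch w x v → InBranch w y v → x ≡ y
InBranch-unique {w = w} {x} {y} (p , refl) (q , eq) =
  ∷ʳ-injectiveʳ p q (++-cancelʳ w (p ∷ʳ x) (q ∷ʳ y)
    (trans (++-assoc p [ x ] w) (trans eq (sym (++-assoc q [ y ] w)))))

InBranch-step : ∀ {d} {w : List (Fin d)} {x} {u v : TreeV d} →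
  TreeAdj u v → InBranch w x u → ¬ word v ≡ w → InBranch w x v
InBranch-step {u = _ , _} {_ , _} (inj₁ (a , refl)) (p , refl)     _   = a ∷ p , refl
InBranch-step {u = _ , _} {_ , _} (inj₂ (a , eq))   ([] , refl)    v≢w = ⊥-elim (v≢w (sym (∷-injectiveʳ eq)))
InBranch-step {u = _ , _} {_ , _} (inj₂ (a , eq))   (_ ∷ p , refl) _   = p , sym (∷-injectiveʳ eq)

module Centred {d : ℕ} {w : List (Fin d)} (r : T (reduced w)) where

  ξ : TreeV d
  ξ = w , r

  word-≡ξ : (v : TreeV d) → word v ≡ w → v ≡ ξ
  word-≡ξ (_ , r′) refl = cong (w ,_) (T-irrelevant r′ r)

  walk-leaves-branch-through-ξ : ∀ {x u v k} → Walk TreeAdj u v k → InBranch w x u →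
    InBranch w x v ⊎ Σ[ k₁ ∈ ℕ ] Σ[ k₂ ∈ ℕ ] (Walk TreeAdj u ξ k₁ × Walk TreeAdj ξ v k₂ × k₁ + k₂ ≡ k)
  walk-leaves-branch-through-ξ here inU = inj₁ inU
  walk-leaves-branch-through-ξ (step {x = u} {y = y} {n = n} e W) inU with ≡-dec _≟ᶠ_ (word y) w
  ... | yes y≡w with refl ← word-≡ξ y y≡w = inj₂ (1 , n , step e here , W , refl)
  ... | no y≢w with walk-leaves-branch-through-ξ W (InBranch-step {u = u} {v = y} e inU y≢w)
  ...   | inj₁ inV                       = inj₁ inV
  ...   | inj₂ (k₁ , k₂ , W₁ , W₂ , eq) = inj₂ (suc k₁ , k₂ , step e W₁ , W₂ , cong suc eq)

  InBranch-or-sum : ∀ {x u v a b c} → ρ≡ ξ u a → ρ≡ ξ v b → ρ≡ u v c →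
    InBranch w x u → InBranch w x v ⊎ c ≡ a + b
  InBranch-or-sum ρa ρb ρc inU with walk-leaves-branch-through-ξ (proj₁ ρc) inU
  ... | inj₁ inV                       = inj₁ inV
  ... | inj₂ (_ , _ , W₁ , W₂ , eq) =
    inj₂ (Dist-through (λ {u} {v} → TreeAdj-sym {x = u} {y = v}) ρa ρb ρc W₁ W₂ eq)

  -- A geodesic ray from ξ into the x-branch; the letter y only keeps the word reduced.
  module Ray {x y : Fin d} (x-fresh : T (noBack x w)) (x≢y : ¬ x ≡ y) where

    rayWord : ℕ → List (Fin d)
    rayWord zero    = w
    rayWord (suc n) = alternating x y n ∷ rayWord n

    rayWord-reduced : ∀ n → T (reduced (rayWord n))
    rayWord-reduced zero          = r
    rayWord-reduced (suc zero)    = reduced-∷ x w x-fresh r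
    rayWord-reduced (suc (suc n)) =
      reduced-∷ (alternating y x n) (rayWord (suc n))
        (fromWitnessFalse (alternating-≢ n (x≢y ∘ sym))) (rayWord-reduced (suc n))

    ray : ℕ → TreeV d
    ray n = rayWord n , rayWord-reduced n

    length-rayWord : ∀ n → length (rayWord n) ≡ n + length w
    length-rayWord zero    = refl
    length-rayWord (suc n) = cong suc (length-rayWord n)

    ray-walk : ∀ n → Walk TreeAdj ξ (ray n) n
    ray-walk zero    = here
    ray-walk (suc n) = ray-walk n ▻ inj₁ (alternating x y n , refl)

    ray-dist : ∀ n → ρ≡ ξ (ray n) n
    ray-dist n = ray-walk n , λ k W →
      +-cancelʳ-≤ (length w) n k (≤-trans (≤-reflexive (sym (length-rayWord n))) (walk-length-≤ W))

    ray-InBranch : ∀ n → InBranch w x (ray (suc n))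
    ray-InBranch zero    = [] , refl
    ray-InBranch (suc n) = let p , eq = ray-InBranch n in alternating y x n ∷ p , cong (_ ∷_) eq

  centre : (S : List ℕ) → PolyV d S
  centre S = replicate (length S) ξ

  PolyAdj-centre-map : (f : ℕ → TreeV d) → (∀ n → ρ≡ ξ (f n) n) →
    (S : List ℕ) → PolyAdj d S (centre S) (map f (fromList S))
  PolyAdj-centre-map f f-dist S = fromList S , coordinate-dist , ↭-reflexive (toList∘fromList S)
    where
    coordinate-dist : ∀ i → ρ≡ (lookup (centre S) i) (lookup (map f (fromList S)) i) (lookup (fromList S) i)
    coordinate-dist i = subst₂ (λ u v → ρ≡ u v _)
      (sym (lookup-replicate i ξ)) (sym (lookup-map i f (fromList S))) (f-dist _)

  linkVertex-map : (f : ℕ → TreeV d) → (∀ n → ρ≡ ξ (f n) n) →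
    ∀ s S → LinkV d (suc s ∷ S) (centre (suc s ∷ S))
  linkVertex-map f f-dist s S =
    map f (fromList (suc s ∷ S)) , PolyAdj-centre-map f f-dist (suc s ∷ S) ,
    Dist-suc⇒≢ (f-dist (suc s)) ∘ cong head

  module _ {S : List ℕ} {x : Fin d} (i : Fin (length S)) where

    OnSide : LinkV d S (centre S) → Set
    OnSide u = InBranch w x (lookup (proj₁ u) i) ⊎ Conclusion S

    LinkAdj-OnSide : ∀ {u v} → LinkAdj d S (centre S) u v → OnSide u → OnSide v
    LinkAdj-OnSide {u , (nu , ρu , nu↭S) , _} {v , (nv , ρv , nv↭S) , _} (nc , ρc , nc↭S) =
      [ [ inj₁ , inj₂ ∘ sum-∈⇒Conclusion (∈S nu↭S) (∈S nv↭S) (∈S nc↭S) ]′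
          ∘ InBranch-or-sum (from-centre {u} {nu} ρu) (from-centre {v} {nv} ρv) (ρc i)
      , inj₂ ]′
      where
      ∈S : ∀ {ns : Vec ℕ (length S)} → toList ns ↭ S → lookup ns i ∈ S
      ∈S ns↭S = ∈-resp-↭ ns↭S (∈-toList⁺ (∈-lookup i _))
      from-centre : ∀ {y ns} → (∀ j → ρ≡ (lookup (centre S) j) (lookup y j) (lookup ns j)) →
        ρ≡ ξ (lookup y i) (lookup ns i)
      from-centre ρy = subst (λ z → ρ≡ z _ _) (lookup-replicate i ξ) (ρy i)

    Star-OnSide : ∀ {u v} → Star (LinkAdj d S (centre S)) u v → OnSide u → OnSide v
    Star-OnSide = fold (λ u v → OnSide u → OnSide v) (λ {u} {v} e k → k ∘ LinkAdj-OnSide {u} {v} e) id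

  fresh-letters⇒Conclusion : ∀ {x y s S} → T (noBack x w) → T (noBack y w) → ¬ x ≡ y →
    LinkConnected d (suc s ∷ S) (centre (suc s ∷ S)) → Conclusion (suc s ∷ S)
  fresh-letters⇒Conclusion {s = s} {S} x-fresh y-fresh x≢y (_ , connected) =
    [ (λ inX → ⊥-elim (x≢y (InBranch-unique {v = Y.ray (suc s)} inX (Y.ray-InBranch s)))) , id ]′
      (Star-OnSide zero (connected (linkVertex-map X.ray X.ray-dist s S)
                                   (linkVertex-map Y.ray Y.ray-dist s S))
                        (inj₁ (X.ray-InBranch s)))
    where
    module X = Ray x-fresh x≢y
    module Y = Ray y-fresh (x≢y ∘ sym)

two-fresh-letters : ∀ {d} → 3 ≤ d → (w : List (Fin d)) →
  Σ[ x ∈ Fin d ] Σ[ y ∈ Fin d ] (T (noBack x w) × T (noBack y w) × ¬ x ≡ y)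
two-fresh-letters (s≤s (s≤s (s≤s _))) []                  = zero , suc zero , _ , _ , λ ()
two-fresh-letters (s≤s (s≤s (s≤s _))) (zero ∷ _)          =
  suc zero , suc (suc zero) , _ , _ , λ ()
two-fresh-letters (s≤s (s≤s (s≤s _))) (suc zero ∷ _)      =
  zero , suc (suc zero) , _ , _ , λ ()
two-fresh-letters (s≤s (s≤s (s≤s _))) (suc (suc _) ∷ _)   =
  zero , suc zero , _ , _ , λ ()

lemma3p3 : (d : ℕ) → 3 ≤ d → (S : List ℕ) → (ξ : TreeV d) →
    LinkConnected d S (replicate (length S) ξ) →
    (0 ∈ S)
    ⊎ (Σ[ s ∈ ℕ ] (s ∈ S × 0 < s × 2 * s ∈ S))
    ⊎ (Σ[ s ∈ ℕ ] Σ[ s′ ∈ ℕ ] Σ[ s″ ∈ ℕ ]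
         (s ∈ S × s′ ∈ S × s″ ∈ S
          × ¬ (s ≡ s′) × ¬ (s ≡ s″) × ¬ (s′ ≡ s″)
          × s″ ≡ s + s′))
lemma3p3 d _   []          ξ       ((Data.Vec.[] , _ , []≢[]) , _) = ⊥-elim ([]≢[] refl)
lemma3p3 d _   (zero ∷ S)  ξ       _         = inj₁ (here refl)
lemma3p3 d 3≤d (suc s ∷ S) (w , r) connected =
  let x , y , x-fresh , y-fresh , x≢y = two-fresh-letters 3≤d w
  in Centred.fresh-letters⇒Conclusion r x-fresh y-fresh x≢y connected
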